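{- Let $p\ge1$, $q\ge 0$, and let $r_1\le r_2\le\cdots\le r_{p+q}$ be nonnegative integers. For every integer $n\ge0$, $$B_n(z;\mathbf{r}_p)=\sum_{k=0}^{|\mathbf{r}_{p-1}|}a_k(\mathbf{r}_{p-1})\,B_{n+k}(z;r_p),$$ $$B_n(z;\mathbf{r}_{p+q})=\sum_{k=0}^{|\mathbf{r}_{p-1}|}a_k(\mathbf{r}_{p-1})\,B_{n+k}(z;r_p,\ldots,r_{p+q}).$$
   Context: For a vector $\mathbf{s}=(s_1,\ldots,s_m)$ of nonnegative integers with $s_1\le\cdots\le s_m$, write $|\mathbf{s}|=s_1+\cdots+s_m$, and $\mathbf{r}_j=(r_1,\ldots,r_j)$. Let $S_1=\{1,\ldots,s_1\}$, $S_2=\{s_1+1,\ldots,s_1+s_2\}$, ..., $S_m$ the next $s_m$ integers. The number ${N\brace k}_{\mathbf{s}}$ is the number of partitions of $\{1,\ldots,N\}$ into $k$ nonempty blocks such that, for each $i$, the elements of $S_i$ lie in pairwise distinct blocks; and $B_n(z;\mathbf{s})=\sum_{k=0}^{n+s_1+\cdots+s_{m-1}}{n+|\mathbf{s}|\brace k+s_m}_{\mathbf{s}}z^k$ (for $m=1$ this is the $r$-Bell polynomial $B_n(z;r)=\sum_{k=0}^n{n+r\brace k+r}_r z^k$). With $\genfrac{[}{]}{0pt}{}{n}{k}$ the unsigned Stirling numbers of the first kind, $$a_k(\mathbf{r}_{p-1})=(-1)^{|\mathbf{r}_{p-1}|-k}\sum_{j_1+\cdots+j_{p-1}=k}\genfrac{[}{]}{0pt}{}{r_1}{j_1}\cdots\genfrac{[}{]}{0pt}{}{r_{p-1}}{j_{p-1}},$$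 equivalently $\sum_k a_k(\mathbf{r}_{p-1})u^k=u^{\underline{r_1}}\cdots u^{\underline{r_{p-1}}}$ where $u^{\underline{r}}=u(u-1)\cdots(u-r+1)$. -}

module Defs where

open import Data.Bool using (Bool; true; false; _∧_; not; if_then_else_)
open import Data.Nat using (ℕ; zero; suc; _+_; _*_; _∸_; _≡ᵇ_; _≤ᵇ_)
open import Data.Integer using (ℤ; +_; -_) renaming (_+_ to _+ℤ_; _*_ to _*ℤ_)
open import Data.List using (List; []; _∷_; take; drop; map; concatMap; length; upTo)
open import Data.Nat.ListAction using (sum)
open import Data.Product using (_×_; _,_)

-- Set partitions of {0,…,N-1} encoded canonically as labelings
-- ℓ = (ℓ₀,…,ℓ_{N-1}) where ℓᵢ is the index of the block containing i,
-- blocks being numbered 0,1,2,… in order of their least element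
-- (restricted growth strings).  This is a bijective encoding of
-- set partitions; a partition has k blocks iff labels 0..k-1 are used.

labelings : ℕ → ℕ → List (List ℕ)
labelings zero    k = [] ∷ []
labelings (suc N) k = concatMap (λ w → map (λ x → x ∷ w) (upTo k)) (labelings N k)

-- canonical-form check: scanning left to right with `next` = number of
-- blocks opened so far, each label is an old block (< next) or opens
-- the next block (= next).
canonicalWith : ℕ → List ℕ → ℕ → Bool
canonicalWith next []       k = next ≡ᵇ k
canonicalWith next (x ∷ xs) k =
  if x ≡ᵇ next then canonicalWith (suc next) xs k
  else (if suc x ≤ᵇ next then canonicalWith next xs k else false)

elem : ℕ → List ℕ → Bool
elem x []       = false
elem x (y ∷ ys) = if x ≡ᵇ y then true else elem x ys

allDistinct : List ℕ → Bool
allDistinct []       = true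
allDistinct (x ∷ xs) = not (elem x xs) ∧ allDistinct xs

-- restriction: the consecutive segments S₁ (first s₁ elements),
-- S₂ (next s₂), … each lie in pairwise distinct blocks
respects : List ℕ → List ℕ → Bool
respects []       ℓ = true
respects (a ∷ s) ℓ = allDistinct (take a ℓ) ∧ respects s (drop a ℓ)

valid : List ℕ → ℕ → List ℕ → Bool
valid s k ℓ = canonicalWith 0 ℓ k ∧ respects s ℓ

countTrue : (List ℕ → Bool) → List (List ℕ) → ℕ
countTrue P []       = 0
countTrue P (x ∷ xs) = if P x then suc (countTrue P xs) else countTrue P xs

-- {N brace k}_s : number of partitions of {1..N} into k nonempty blocks
-- with each S_i in pairwise distinct blocks.
-- (the labeling lists the labels of the elements 1,…,N in order)
StirlingR : ℕ → ℕ → List ℕ → ℕ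
StirlingR N k s = countTrue (valid s k) (labelings N k)

splitLast : List ℕ → List ℕ × ℕ
splitLast []           = [] , 0
splitLast (x ∷ [])     = [] , x
splitLast (x ∷ y ∷ xs) with splitLast (y ∷ xs)
... | is , l = (x ∷ is) , l

initS : List ℕ → List ℕ
initS s with splitLast s
... | is , l = is

lastS : List ℕ → ℕ
lastS s with splitLast s
... | is , l = l

-- coefficient of z^j in B_n(z; s) = Σ_{k=0}^{n+s₁+…+s_{m-1}} {n+|s| brace k+s_m}_s z^k
-- (a polynomial is identified with its coefficient sequence ℕ → ℕ)
Bcoeff : ℕ → List ℕ → ℕ → ℕ
Bcoeff n s j =
  if j ≤ᵇ (n + sum (initS s)) then StirlingR (n + sum s) (j + lastS s) s else 0

stirling1 : ℕ → ℕ → ℕ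
stirling1 zero    zero    = 1
stirling1 zero    (suc k) = 0
stirling1 (suc n) zero    = 0
stirling1 (suc n) (suc k) = n * stirling1 n (suc k) + stirling1 n k

sumTo : ℕ → (ℕ → ℤ) → ℤ
sumTo zero    f = f 0
sumTo (suc M) f = sumTo M f +ℤ f (suc M)

sumToℕ : ℕ → (ℕ → ℕ) → ℕ
sumToℕ zero    f = f 0
sumToℕ (suc M) f = sumToℕ M f + f (suc M)

conv : List ℕ → ℕ → ℕ
conv []       zero    = 1
conv []       (suc k) = 0
conv (r ∷ rs) k       = sumToℕ k (λ j → stirling1 r j * conv rs (k ∸ j))

signPow : ℕ → ℤ
signPow zero    = + 1
signPow (suc m) = - signPow m

-- a_k(r) = (-1)^{|r|-k} Σ_{j₁+…=k} Π [r_i j_i]   (used for 0 ≤ k ≤ |r|)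
aCoeff : List ℕ → ℕ → ℤ
aCoeff r k = signPow (sum r ∸ k) *ℤ (+ conv r k)

module Submission where

-- Count the colourings of {1,…,N} with x colours in which every segment S_i receives distinct colours.
-- Colouring the elements one after the other gives (x)_{s₁}⋯(x)_{s_m} x^{N−|s|}, where (x)_d is the
-- falling factorial; grouping the colourings by their partition into colour classes gives
-- Σ_K {N brace K}_s (x)_K.  If s is r₁,…,r_{p−1} followed by s′, the factor (x)_{r₁}⋯(x)_{r_{p−1}} is
-- Σ_k a_k x^k by the generating function of the Stirling numbers of the first kind, hence
-- Σ_K {n+|s| brace K}_s (x)_K = Σ_k a_k Σ_K {n+k+|s′| brace K}_{s′} (x)_K for every x.  The falling
-- factorials are linearly independent (evaluate at x = 0, 1, 2, …), so the coefficients of (x)_K agree,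
-- and the coefficient of z^j in B_n(z; s) is the one with K = j + s_m.
-- Both counts obey a recursion on the first element, and it is through these recursions that the
-- partition count, expanded in falling factorials, is matched with the colouring count.

open import Defs
open import Data.Bool using (Bool; true; false; T; _∧_; not; if_then_else_)
import Data.Bool.Solver
open import Data.Bool.Properties using (∧-identityʳ; ∧-zeroʳ; ∧-assoc; T-∧; T-not-≡)
open import Data.Nat
open import Data.Nat.Properties
open import Data.Nat.Induction using (<-rec)
open import Relation.Binary.Definitions using (tri<; tri≈; tri>)
open import Data.Nat.Tactic.RingSolver using (solve-∀)
open import Data.Integer using (ℤ; +_; -_; 0ℤ; 1ℤ; -1ℤ)
  renaming (_+_ to _+ℤ_; _*_ to _*ℤ_; _-_ to _-ℤ_; _^_ to _^ℤ_)
import Data.Integer.Properties as ℤ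
open import Data.Integer.Tactic.RingSolver using () renaming (solve-∀ to ℤ-solve-∀)
open import Data.Nat.ListAction using (sum)
open import Data.Nat.ListAction.Properties using (sum-++)
open import Data.List using (List; []; _∷_; _++_; map; concatMap; applyUpTo; upTo; length; take; drop)
open import Data.List.Properties using (take++drop≡id; take-take; length-take; length-drop)
open import Data.List.Relation.Unary.Linked using (Linked)
open import Data.List.Relation.Unary.All using (All; []; _∷_)
import Data.List.Relation.Unary.All as All
open import Data.Product using (_×_; _,_; proj₁; proj₂)
open import Data.Sum using (_⊎_; inj₁; inj₂)
open import Function.Bundles using (Equivalence)
open import Function using (_∘_; id)
open import Relation.Nullary using (¬_; yes; no; contradiction)
open import Relation.Binary.PropositionalEquality
open ≡-Reasoning

true-if-T : ∀ {b} → T b → b ≡ true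
true-if-T {true} _ = refl

false-if-¬T : ∀ {b} → ¬ T b → b ≡ false
false-if-¬T {true}  ¬t = contradiction _ ¬t
false-if-¬T {false} _  = refl

≡ᵇ-refl : ∀ n → (n ≡ᵇ n) ≡ true
≡ᵇ-refl n = true-if-T (≡⇒≡ᵇ n n refl)

≡ᵇ-false : ∀ {m n} → m ≢ n → (m ≡ᵇ n) ≡ false
≡ᵇ-false {m} {n} m≢n = false-if-¬T (m≢n ∘ ≡ᵇ⇒≡ m n)

≡ᵇ-sym : ∀ m n → (m ≡ᵇ n) ≡ (n ≡ᵇ m)
≡ᵇ-sym zero    zero    = refl
≡ᵇ-sym zero    (suc n) = refl
≡ᵇ-sym (suc m) zero    = refl
≡ᵇ-sym (suc m) (suc n) = ≡ᵇ-sym m n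

<ᵇ-true : ∀ {m n} → m < n → (m <ᵇ n) ≡ true
<ᵇ-true m<n = true-if-T (<⇒<ᵇ m<n)

<ᵇ-false : ∀ {m n} → n ≤ m → (m <ᵇ n) ≡ false
<ᵇ-false {m} {n} n≤m = false-if-¬T (λ t → ≤⇒≯ n≤m (<ᵇ⇒< m n t))

elem-false : ∀ {n E} → All (_< n) E → elem n E ≡ false
elem-false         []           = refl
elem-false {n} {y ∷ E} (y<n ∷ E<n) rewrite ≡ᵇ-false {n} {y} (>⇒≢ y<n) = elem-false E<n

sumBelow : ℕ → (ℕ → ℕ) → ℕ
sumBelow zero    f = 0
sumBelow (suc k) f = f 0 + sumBelow k (f ∘ suc)

sumBelow-cong : ∀ k {f g : ℕ → ℕ} → (∀ x → x < k → f x ≡ g x) → sumBelow k f ≡ sumBelow k g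
sumBelow-cong zero    f≗g = refl
sumBelow-cong (suc k) f≗g = cong₂ _+_ (f≗g 0 z<s) (sumBelow-cong k (λ x x<k → f≗g (suc x) (s<s x<k)))

sumBelow-zero : ∀ k {f : ℕ → ℕ} → (∀ x → f x ≡ 0) → sumBelow k f ≡ 0
sumBelow-zero zero    f≗0 = refl
sumBelow-zero (suc k) f≗0 = cong₂ _+_ (f≗0 0) (sumBelow-zero k (f≗0 ∘ suc))

sumBelow-+ : ∀ k (f g : ℕ → ℕ) → sumBelow k (λ x → f x + g x) ≡ sumBelow k f + sumBelow k g
sumBelow-+ zero    f g = refl
sumBelow-+ (suc k) f g rewrite sumBelow-+ k (f ∘ suc) (g ∘ suc) = interchange (f 0) (g 0) _ _
  where
  interchange : ∀ a b c d → (a + b) + (c + d) ≡ (a + c) + (b + d)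
  interchange = solve-∀

sumBelow-*ˡ : ∀ k c (f : ℕ → ℕ) → sumBelow k (λ x → c * f x) ≡ c * sumBelow k f
sumBelow-*ˡ zero    c f = sym (*-zeroʳ c)
sumBelow-*ˡ (suc k) c f rewrite sumBelow-*ˡ k c (f ∘ suc) = sym (*-distribˡ-+ c (f 0) _)

sumBelow-+-split : ∀ m d (f : ℕ → ℕ) → sumBelow (m + d) f ≡ sumBelow m f + sumBelow d (λ x → f (m + x))
sumBelow-+-split zero    d f = refl
sumBelow-+-split (suc m) d f rewrite sumBelow-+-split m d (f ∘ suc) = sym (+-assoc (f 0) _ _)

sumBelow-indicator : ∀ k m c → m < k → sumBelow k (λ x → if x ≡ᵇ m then c else 0) ≡ c
sumBelow-indicator (suc k) zero    c _         = trans (cong (_+_ c) (sumBelow-zero k (λ _ → refl))) (+-identityʳ c)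
sumBelow-indicator (suc k) (suc m) c (s<s m<k) = sumBelow-indicator k m c m<k

sumBelow-indicator-≥ : ∀ k m c → k ≤ m → sumBelow k (λ x → if x ≡ᵇ m then c else 0) ≡ 0
sumBelow-indicator-≥ zero    m       c _         = refl
sumBelow-indicator-≥ (suc k) (suc m) c (s≤s k≤m) = sumBelow-indicator-≥ k m c k≤m

⟦_⟧ : Bool → ℕ
⟦ b ⟧ = if b then 1 else 0

countTrue-∷ : ∀ P (w : List ℕ) L → countTrue P (w ∷ L) ≡ ⟦ P w ⟧ + countTrue P L
countTrue-∷ P w L with P w
... | true  = refl
... | false = refl

countTrue-++ : ∀ P (L L′ : List (List ℕ)) → countTrue P (L ++ L′) ≡ countTrue P L + countTrue P L′
countTrue-++ P []      L′ = refl
countTrue-++ P (w ∷ L) L′ = begin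
  countTrue P (w ∷ L ++ L′)              ≡⟨ countTrue-∷ P w (L ++ L′) ⟩
  ⟦ P w ⟧ + countTrue P (L ++ L′)        ≡⟨ cong (_+_ ⟦ P w ⟧) (countTrue-++ P L L′) ⟩
  ⟦ P w ⟧ + (countTrue P L + countTrue P L′) ≡⟨ sym (+-assoc ⟦ P w ⟧ _ _) ⟩
  (⟦ P w ⟧ + countTrue P L) + countTrue P L′ ≡⟨ cong (_+ countTrue P L′) (sym (countTrue-∷ P w L)) ⟩
  countTrue P (w ∷ L) + countTrue P L′   ∎

countTrue-cong : ∀ {P Q} → (∀ w → P w ≡ Q w) → ∀ L → countTrue P L ≡ countTrue Q L
countTrue-cong P≗Q []      = refl
countTrue-cong {P} {Q} P≗Q (w ∷ L)
  rewrite countTrue-∷ P w L | countTrue-∷ Q w L | P≗Q w | countTrue-cong P≗Q L = refl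

countTrue-none : ∀ {P} → (∀ w → P w ≡ false) → ∀ L → countTrue P L ≡ 0
countTrue-none P≗false []      = refl
countTrue-none {P} P≗false (w ∷ L) rewrite countTrue-∷ P w L | P≗false w = countTrue-none P≗false L

countTrue-map-applyUpTo : ∀ P (h : ℕ → List ℕ) (f : ℕ → ℕ) k →
  countTrue P (map h (applyUpTo f k)) ≡ sumBelow k (λ x → ⟦ P (h (f x)) ⟧)
countTrue-map-applyUpTo P h f zero    = refl
countTrue-map-applyUpTo P h f (suc k) =
  trans (countTrue-∷ P (h (f 0)) (map h (applyUpTo (f ∘ suc) k)))
        (cong (_+_ ⟦ P (h (f 0)) ⟧) (countTrue-map-applyUpTo P h (f ∘ suc) k))

countTrue-labelings-suc : ∀ N k P →
  countTrue P (labelings (suc N) k) ≡ sumBelow k (λ x → countTrue (P ∘ (x ∷_)) (labelings N k))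
countTrue-labelings-suc N k P = go (labelings N k)
  where
  go : ∀ L → countTrue P (concatMap (λ w → map (_∷ w) (upTo k)) L)
           ≡ sumBelow k (λ x → countTrue (P ∘ (x ∷_)) L)
  go []      = sym (sumBelow-zero k (λ _ → refl))
  go (w ∷ L) = begin
    countTrue P (map (_∷ w) (upTo k) ++ concatMap (λ w → map (_∷ w) (upTo k)) L)
      ≡⟨ countTrue-++ P (map (_∷ w) (upTo k)) _ ⟩
    countTrue P (map (_∷ w) (upTo k)) + countTrue P (concatMap (λ w → map (_∷ w) (upTo k)) L)
      ≡⟨ cong₂ _+_ (countTrue-map-applyUpTo P (_∷ w) id k) (go L) ⟩
    sumBelow k (λ x → ⟦ P (x ∷ w) ⟧) + sumBelow k (λ x → countTrue (P ∘ (x ∷_)) L)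
      ≡⟨ sym (sumBelow-+ k _ _) ⟩
    sumBelow k (λ x → ⟦ P (x ∷ w) ⟧ + countTrue (P ∘ (x ∷_)) L)
      ≡⟨ sumBelow-cong k (λ x _ → sym (countTrue-∷ (P ∘ (x ∷_)) w L)) ⟩
    sumBelow k (λ x → countTrue (P ∘ (x ∷_)) (w ∷ L)) ∎

-- canonicalWith on a label x: x opens block `next`, reuses one of the blocks below `next`, or is invalid.
branch : {A : Set} → A → (x next : ℕ) → A → A → A
branch none x next new old = if x ≡ᵇ next then new else (if suc x ≤ᵇ next then old else none)

branch-∧ : ∀ x next new old b → branch false x next new old ∧ b ≡ branch false x next (new ∧ b) (old ∧ b)
branch-∧ x next new old b with x ≡ᵇ next
... | true  = refl
... | false with suc x ≤ᵇ next
...   | true  = refl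
...   | false = refl

branch-false : ∀ x next → branch false x next false false ≡ false
branch-false x next = trans (sym (branch-∧ x next true true false)) (∧-zeroʳ (branch false x next true true))

branch-+ : ∀ x next a b → branch 0 x next a b ≡ (if x ≡ᵇ next then a else 0) + (if suc x ≤ᵇ next then b else 0)
branch-+ x next a b with x ≡ᵇ next | ≡ᵇ⇒≡ x next
... | true  | toEq rewrite toEq _ | <ᵇ-false (≤-refl {next}) = sym (+-identityʳ a)
... | false | _    = refl

countTrue-branch : ∀ x next (P Q : List ℕ → Bool) L →
  countTrue (λ w → branch false x next (P w) (Q w)) L ≡ branch 0 x next (countTrue P L) (countTrue Q L)
countTrue-branch x next P Q L with x ≡ᵇ next
... | true  = refl
... | false with suc x ≤ᵇ next
...   | true  = refl
...   | false = countTrue-none (λ _ → refl) L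

countTrue-∧ : ∀ g (P : List ℕ → Bool) L → countTrue (λ w → g ∧ P w) L ≡ (if g then countTrue P L else 0)
countTrue-∧ true  P L = refl
countTrue-∧ false P L = countTrue-none (λ _ → refl) L

sumBelow-truncate : ∀ {m K} (f : ℕ → ℕ) → m ≤ K → sumBelow K (λ x → if suc x ≤ᵇ m then f x else 0) ≡ sumBelow m f
sumBelow-truncate {m} {K} f m≤K = begin
  sumBelow K g                                      ≡⟨ cong (λ k → sumBelow k g) (sym (m+[n∸m]≡n m≤K)) ⟩
  sumBelow (m + (K ∸ m)) g                          ≡⟨ sumBelow-+-split m (K ∸ m) g ⟩
  sumBelow m g + sumBelow (K ∸ m) (λ d → g (m + d))
    ≡⟨ cong₂ _+_ (sumBelow-cong m below) (sumBelow-zero (K ∸ m) above) ⟩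
  sumBelow m f + 0                                  ≡⟨ +-identityʳ _ ⟩
  sumBelow m f                                      ∎
  where
  g : ℕ → ℕ
  g x = if suc x ≤ᵇ m then f x else 0
  below : ∀ x → x < m → g x ≡ f x
  below x x<m rewrite <ᵇ-true x<m = refl
  above : ∀ d → g (m + d) ≡ 0
  above d rewrite <ᵇ-false (m≤m+n m d) = refl

sumBelow-notElem : ∀ m E → T (allDistinct E) → All (_< m) E →
  sumBelow m (λ x → if elem x E then 0 else 1) ≡ m ∸ length E
sumBelow-notElem m []      _        []          = sumBelow-1 m
  where
  sumBelow-1 : ∀ m → sumBelow m (λ _ → 1) ≡ m
  sumBelow-1 zero    = refl
  sumBelow-1 (suc m) = cong suc (sumBelow-1 m)
sumBelow-notElem m (y ∷ E) distinct (y<m ∷ E<m) = begin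
  S                                 ≡⟨ sym (m+n∸n≡m S 1) ⟩
  (S + 1) ∸ 1                       ≡⟨ cong (_∸ 1) split ⟩
  sumBelow m notIn ∸ 1              ≡⟨ cong (_∸ 1) (sumBelow-notElem m E distinctE E<m) ⟩
  (m ∸ length E) ∸ 1                ≡⟨ ∸-+-assoc m (length E) 1 ⟩
  m ∸ (length E + 1)                ≡⟨ cong (m ∸_) (+-comm (length E) 1) ⟩
  m ∸ length (y ∷ E)                ∎
  where
  notIn notIn′ : ℕ → ℕ
  notIn  x = if elem x E then 0 else 1
  notIn′ x = if elem x (y ∷ E) then 0 else 1
  S = sumBelow m notIn′
  y∉E : elem y E ≡ false
  y∉E = Equivalence.to T-not-≡ (proj₁ (Equivalence.to T-∧ distinct))
  distinctE : T (allDistinct E)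
  distinctE = proj₂ (Equivalence.to T-∧ distinct)
  pointwise : ∀ x → notIn x ≡ notIn′ x + (if x ≡ᵇ y then 1 else 0)
  pointwise x with x ≡ᵇ y | ≡ᵇ⇒≡ x y
  ... | true  | toEq rewrite toEq _ | y∉E = refl
  ... | false | _    = sym (+-identityʳ _)
  split : S + 1 ≡ sumBelow m notIn
  split = sym (begin
    sumBelow m notIn                                            ≡⟨ sumBelow-cong m (λ x _ → pointwise x) ⟩
    sumBelow m (λ x → notIn′ x + (if x ≡ᵇ y then 1 else 0))      ≡⟨ sumBelow-+ m notIn′ _ ⟩
    S + sumBelow m (λ x → if x ≡ᵇ y then 1 else 0)              ≡⟨ cong (_+_ S) (sumBelow-indicator m y 1 y<m) ⟩
    S + 1                                                       ∎)

sumBelow-firstLabel : ∀ K next E cNew cOld → next ≤ K → (next ≡ K → cNew ≡ 0) → T (allDistinct E) → All (_< next) E →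
  sumBelow K (λ x → branch 0 x next cNew (if elem x E then 0 else cOld)) ≡ (next ∸ length E) * cOld + cNew
sumBelow-firstLabel K next E cNew cOld next≤K noRoom distinct E<next = begin
  sumBelow K (λ x → branch 0 x next cNew (reuse x))  ≡⟨ sumBelow-cong K (λ x _ → branch-+ x next cNew (reuse x)) ⟩
  sumBelow K (λ x → opens x + reuses x)              ≡⟨ sumBelow-+ K opens reuses ⟩
  sumBelow K opens + sumBelow K reuses               ≡⟨ cong₂ _+_ opened reused ⟩
  cNew + (next ∸ length E) * cOld                    ≡⟨ +-comm cNew _ ⟩
  (next ∸ length E) * cOld + cNew                    ∎
  where
  reuse opens reuses : ℕ → ℕ
  reuse  x = if elem x E then 0 else cOld
  opens  x = if x ≡ᵇ next then cNew else 0
  reuses x = if suc x ≤ᵇ next then reuse x else 0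
  opened : sumBelow K opens ≡ cNew
  opened with m≤n⇒m<n∨m≡n next≤K
  ... | inj₁ next<K = sumBelow-indicator K next cNew next<K
  ... | inj₂ refl   = trans (sumBelow-indicator-≥ K K cNew ≤-refl) (sym (noRoom refl))
  reuse-* : ∀ x → reuse x ≡ cOld * (if elem x E then 0 else 1)
  reuse-* x with elem x E
  ... | true  = sym (*-zeroʳ cOld)
  ... | false = sym (*-identityʳ cOld)
  reused : sumBelow K reuses ≡ (next ∸ length E) * cOld
  reused = begin
    sumBelow K reuses                                        ≡⟨ sumBelow-truncate reuse next≤K ⟩
    sumBelow next reuse                                      ≡⟨ sumBelow-cong next (λ x _ → reuse-* x) ⟩
    sumBelow next (λ x → cOld * (if elem x E then 0 else 1)) ≡⟨ sumBelow-*ˡ next cOld _ ⟩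
    cOld * sumBelow next (λ x → if elem x E then 0 else 1)
      ≡⟨ cong (cOld *_) (sumBelow-notElem next E distinct E<next) ⟩
    cOld * (next ∸ length E)                                 ≡⟨ *-comm cOld _ ⟩
    (next ∸ length E) * cOld                                 ∎

countTrue-firstLabel : ∀ N K next E (P : List ℕ → Bool) (new old : ℕ → List ℕ → Bool) cNew cOld →
  next ≤ K → (next ≡ K → cNew ≡ 0) → T (allDistinct E) → All (_< next) E →
  (∀ x w → P (x ∷ w) ≡ branch false x next (not (elem x E) ∧ new x w) (not (elem x E) ∧ old x w)) →
  countTrue (new next) (labelings N K) ≡ cNew →
  (∀ x → x < next → elem x E ≡ false → countTrue (old x) (labelings N K) ≡ cOld) →
  countTrue P (labelings (suc N) K) ≡ (next ∸ length E) * cOld + cNew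
countTrue-firstLabel N K next E P new old cNew cOld next≤K noRoom distinct E<next unfold countNew countOld = begin
  countTrue P (labelings (suc N) K)                                  ≡⟨ countTrue-labelings-suc N K P ⟩
  sumBelow K (λ x → countTrue (P ∘ (x ∷_)) L)                        ≡⟨ sumBelow-cong K (λ x _ → byFirstLabel x) ⟩
  sumBelow K (λ x → branch 0 x next cNew (if elem x E then 0 else cOld))
    ≡⟨ sumBelow-firstLabel K next E cNew cOld next≤K noRoom distinct E<next ⟩
  (next ∸ length E) * cOld + cNew                                    ∎
  where
  L = labelings N K
  cases : ∀ x → branch 0 x next (if not (elem x E) then countTrue (new x) L else 0)
                                (if not (elem x E) then countTrue (old x) L else 0)
              ≡ branch 0 x next cNew (if elem x E then 0 else cOld)
  cases x with x ≡ᵇ next | ≡ᵇ⇒≡ x next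
  ... | true  | toEq rewrite toEq _ | elem-false E<next = countNew
  ... | false | _ with suc x ≤ᵇ next | ≤ᵇ⇒≤ (suc x) next
  ...   | false | _ = refl
  ...   | true  | x<next with elem x E in x∈E
  ...     | true  = refl
  ...     | false = countOld x (x<next _) x∈E
  byFirstLabel : ∀ x → countTrue (P ∘ (x ∷_)) L ≡ branch 0 x next cNew (if elem x E then 0 else cOld)
  byFirstLabel x = begin
    countTrue (P ∘ (x ∷_)) L
      ≡⟨ countTrue-cong (unfold x) L ⟩
    countTrue (λ w → branch false x next (g ∧ new x w) (g ∧ old x w)) L
      ≡⟨ countTrue-branch x next (λ w → g ∧ new x w) (λ w → g ∧ old x w) L ⟩
    branch 0 x next (countTrue (λ w → g ∧ new x w) L) (countTrue (λ w → g ∧ old x w) L)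
      ≡⟨ cong₂ (branch 0 x next) (countTrue-∧ g (new x) L) (countTrue-∧ g (old x) L) ⟩
    branch 0 x next (if g then countTrue (new x) L else 0) (if g then countTrue (old x) L else 0)
      ≡⟨ cases x ⟩
    branch 0 x next cNew (if elem x E then 0 else cOld) ∎
    where g = not (elem x E)

-- Restricted Stirling numbers by a first-label recursion

avoids : List ℕ → List ℕ → Bool
avoids E []      = true
avoids E (y ∷ l) = not (elem y E) ∧ avoids E l

avoids-[] : ∀ l → avoids [] l ≡ true
avoids-[] []      = refl
avoids-[] (y ∷ l) = avoids-[] l

avoids-∷ : ∀ x E l → avoids (x ∷ E) l ≡ avoids E l ∧ not (elem x l)
avoids-∷ x E []      = refl
avoids-∷ x E (y ∷ l) rewrite ≡ᵇ-sym y x with x ≡ᵇ y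
... | true  = sym (∧-zeroʳ _)
... | false = trans (cong (not (elem y E) ∧_) (avoids-∷ x E l)) (sym (∧-assoc (not (elem y E)) _ _))

respects-[] : ∀ s → respects s [] ≡ true
respects-[] []          = refl
respects-[] (zero  ∷ s) = respects-[] s
respects-[] (suc a ∷ s) = respects-[] s

-- Validity of the remaining labels w after a prefix that opened the blocks 0, …, next − 1, when the
-- current segment has already met the blocks in E and has a more elements, followed by the segments s.
validFrom : (next : ℕ) → List ℕ → (a : ℕ) → List ℕ → (K : ℕ) → List ℕ → Bool
validFrom next E a s K w =
  canonicalWith next w K ∧ (avoids E (take a w) ∧ (allDistinct (take a w) ∧ respects s (drop a w)))

validFrom-[] : ∀ next E a s K → validFrom next E a s K [] ≡ (next ≡ᵇ K)
validFrom-[] next E zero    s K rewrite respects-[] s = ∧-identityʳ _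
validFrom-[] next E (suc a) s K rewrite respects-[] s = ∧-identityʳ _

validFrom-segment : ∀ next E b s K w → validFrom next E 0 (b ∷ s) K w ≡ validFrom next [] b s K w
validFrom-segment next E b s K w rewrite avoids-[] (take b w) = refl

validFrom-unrestricted : ∀ next K x w → validFrom next [] 0 [] K (x ∷ w)
  ≡ branch false x next (validFrom (suc next) [] 0 [] K w) (validFrom next [] 0 [] K w)
validFrom-unrestricted next K x w = branch-∧ x next _ _ true

∧-regroup : ∀ c e o n d r → c ∧ ((e ∧ o) ∧ ((n ∧ d) ∧ r)) ≡ e ∧ (c ∧ ((o ∧ n) ∧ (d ∧ r)))
∧-regroup = solve 6 (λ c e o n d r → c :* ((e :* o) :* ((n :* d) :* r)) := e :* (c :* ((o :* n) :* (d :* r)))) refl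
  where open Data.Bool.Solver.∨-∧-Solver

validFrom-∷ : ∀ next E a s K x w → validFrom next E (suc a) s K (x ∷ w)
  ≡ branch false x next (not (elem x E) ∧ validFrom (suc next) (x ∷ E) a s K w)
                        (not (elem x E) ∧ validFrom next (x ∷ E) a s K w)
validFrom-∷ next E a s K x w rewrite avoids-∷ x E (take a w) =
  trans (branch-∧ x next _ _ _)
        (cong₂ (branch false x next) (∧-regroup (canonicalWith (suc next) w K) x∉E avoid x∉seg dist rest)
                                     (∧-regroup (canonicalWith next w K) x∉E avoid x∉seg dist rest))
  where
  x∉E avoid x∉seg dist rest : Bool
  x∉E   = not (elem x E)
  avoid = avoids E (take a w)
  x∉seg = not (elem x (take a w))
  dist  = allDistinct (take a w)
  rest  = respects s (drop a w)

canonicalWith-< : ∀ {next K} w → K < next → canonicalWith next w K ≡ false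
canonicalWith-< {next} {K} []      K<next = ≡ᵇ-false (>⇒≢ K<next)
canonicalWith-< {next} {K} (x ∷ w) K<next
  rewrite canonicalWith-< {suc next} w (m<n⇒m<1+n K<next) | canonicalWith-< {next} w K<next = branch-false x next

validFrom-< : ∀ {next K} E a s w → K < next → validFrom next E a s K w ≡ false
validFrom-< E a s w K<next rewrite canonicalWith-< w K<next = refl

-- The number of valid w of length N (countTrue-validFrom).  It depends on E only through u = |E|, since
-- a reused label ranges over the next ∸ u open blocks not yet met in the current segment.
extensions : (N next u a : ℕ) → List ℕ → (K : ℕ) → ℕ
extensions zero    next u a       s       K = if next ≡ᵇ K then 1 else 0
extensions (suc N) next u zero    []      K = next * extensions N next 0 0 [] K + extensions N (suc next) 0 0 [] K
extensions (suc N) next u zero    (b ∷ s) K = extensions (suc N) next 0 b s K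
extensions (suc N) next u (suc a) s       K =
  (next ∸ u) * extensions N next (suc u) a s K + extensions N (suc next) (suc u) a s K

extensions-< : ∀ N {next} u a s {K} → K < next → extensions N next u a s K ≡ 0
extensions-< zero    {next} u a s {K} K<next rewrite ≡ᵇ-false (>⇒≢ K<next) = refl
extensions-< (suc N) {next} u zero [] K<next
  rewrite extensions-< N 0 0 [] K<next | extensions-< N {suc next} 0 0 [] (m<n⇒m<1+n K<next) =
  trans (+-identityʳ _) (*-zeroʳ next)
extensions-< (suc N) u zero (b ∷ s) K<next = extensions-< (suc N) 0 b s K<next
extensions-< (suc N) {next} u (suc a) s K<next
  rewrite extensions-< N (suc u) a s K<next | extensions-< N {suc next} (suc u) a s (m<n⇒m<1+n K<next) =
  trans (+-identityʳ _) (*-zeroʳ (next ∸ u))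

extensions-> : ∀ N {next} u a s {K} → next + N < K → extensions N next u a s K ≡ 0
extensions-> zero    {next} u a s {K} lt rewrite ≡ᵇ-false {next} {K} (<⇒≢ (subst (_< K) (+-identityʳ next) lt)) = refl
extensions-> (suc N) {next} u zero [] {K} lt
  rewrite extensions-> N 0 0 [] (≤-<-trans (+-monoʳ-≤ next (n≤1+n N)) lt)
        | extensions-> N {suc next} 0 0 [] (subst (_< K) (+-suc next N) lt) = trans (+-identityʳ _) (*-zeroʳ next)
extensions-> (suc N) u zero (b ∷ s) lt = extensions-> (suc N) 0 b s lt
extensions-> (suc N) {next} u (suc a) s {K} lt
  rewrite extensions-> N (suc u) a s (≤-<-trans (+-monoʳ-≤ next (n≤1+n N)) lt)
        | extensions-> N {suc next} (suc u) a s (subst (_< K) (+-suc next N) lt) =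
  trans (+-identityʳ _) (*-zeroʳ (next ∸ u))

distinct-∷ : ∀ {x E} → elem x E ≡ false → T (allDistinct E) → T (allDistinct (x ∷ E))
distinct-∷ x∉E distinct rewrite x∉E = distinct

countTrue-validFrom-< : ∀ N {next} E a s {K} → K < next →
  countTrue (validFrom next E a s K) (labelings N K) ≡ extensions N next (length E) a s K
countTrue-validFrom-< N E a s K<next =
  trans (countTrue-none (λ w → validFrom-< E a s w K<next) (labelings N _))
        (sym (extensions-< N (length E) a s K<next))

countTrue-validFrom : ∀ N next E a s K → T (allDistinct E) → All (_< next) E →
  countTrue (validFrom next E a s K) (labelings N K) ≡ extensions N next (length E) a s K
countTrue-validFrom zero next E a s K _ _ rewrite validFrom-[] next E a s K = refl
countTrue-validFrom (suc N) next E zero (b ∷ s) K _ _ =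
  trans (countTrue-cong (validFrom-segment next E b s K) (labelings (suc N) K))
        (countTrue-validFrom (suc N) next [] b s K _ [])
countTrue-validFrom (suc N) next E zero [] K distinct E<next with next ≤? K
... | no next≰K  = countTrue-validFrom-< (suc N) E 0 [] (≰⇒> next≰K)
... | yes next≤K =
  countTrue-firstLabel N K next [] _ (λ _ → validFrom (suc next) [] 0 [] K) (λ _ → validFrom next [] 0 [] K) _ _
    next≤K (λ next≡K → extensions-< N 0 0 [] (≤-reflexive (cong suc (sym next≡K))))
    _ [] (validFrom-unrestricted next K)
    (countTrue-validFrom N (suc next) [] 0 [] K _ [])
    (λ _ _ _ → countTrue-validFrom N next [] 0 [] K _ [])
countTrue-validFrom (suc N) next E (suc a) s K distinct E<next with next ≤? K
... | no next≰K  = countTrue-validFrom-< (suc N) E (suc a) s (≰⇒> next≰K)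
... | yes next≤K =
  countTrue-firstLabel N K next E _ (λ x → validFrom (suc next) (x ∷ E) a s K) (λ x → validFrom next (x ∷ E) a s K) _ _
    next≤K (λ next≡K → extensions-< N (suc (length E)) a s (≤-reflexive (cong suc (sym next≡K))))
    distinct E<next (validFrom-∷ next E a s K)
    (countTrue-validFrom N (suc next) (next ∷ E) a s K (distinct-∷ {next} {E} (elem-false E<next) distinct)
                         (n<1+n next ∷ All.map m<n⇒m<1+n E<next))
    (λ x x<next x∉E → countTrue-validFrom N next (x ∷ E) a s K (distinct-∷ {x} {E} x∉E distinct) (x<next ∷ E<next))

StirlingR≡extensions : ∀ N K s → StirlingR N K s ≡ extensions N 0 0 0 s K
StirlingR≡extensions N K s = countTrue-validFrom N 0 [] 0 s K _ []

StirlingR-vanishes : ∀ {N K} s → N < K → StirlingR N K s ≡ 0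
StirlingR-vanishes {N} {K} s N<K = trans (StirlingR≡extensions N K s) (extensions-> N 0 0 s N<K)

sumTo-cong : ∀ M {f g : ℕ → ℤ} → (∀ i → i ≤ M → f i ≡ g i) → sumTo M f ≡ sumTo M g
sumTo-cong zero    f≗g = f≗g 0 z≤n
sumTo-cong (suc M) f≗g = cong₂ _+ℤ_ (sumTo-cong M (λ i i≤M → f≗g i (m≤n⇒m≤1+n i≤M))) (f≗g (suc M) ≤-refl)

sumTo-zero : ∀ M {f : ℕ → ℤ} → (∀ i → i ≤ M → f i ≡ 0ℤ) → sumTo M f ≡ 0ℤ
sumTo-zero M f≗0 = trans (sumTo-cong M f≗0) (zeros M)
  where
  zeros : ∀ M → sumTo M (λ _ → 0ℤ) ≡ 0ℤ
  zeros zero    = refl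
  zeros (suc M) = trans (ℤ.+-identityʳ _) (zeros M)

sumTo-+ : ∀ M (f g : ℕ → ℤ) → sumTo M (λ i → f i +ℤ g i) ≡ sumTo M f +ℤ sumTo M g
sumTo-+ zero    f g = refl
sumTo-+ (suc M) f g rewrite sumTo-+ M f g = interchange (sumTo M f) (sumTo M g) (f (suc M)) (g (suc M))
  where
  interchange : ∀ a b c d → (a +ℤ b) +ℤ (c +ℤ d) ≡ (a +ℤ c) +ℤ (b +ℤ d)
  interchange = ℤ-solve-∀

sumTo-*ˡ : ∀ M c (f : ℕ → ℤ) → sumTo M (λ i → c *ℤ f i) ≡ c *ℤ sumTo M f
sumTo-*ˡ zero    c f = refl
sumTo-*ˡ (suc M) c f rewrite sumTo-*ˡ M c f = sym (ℤ.*-distribˡ-+ c (sumTo M f) (f (suc M)))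

sumTo-*ʳ : ∀ M (f : ℕ → ℤ) c → sumTo M (λ i → f i *ℤ c) ≡ sumTo M f *ℤ c
sumTo-*ʳ M f c = begin
  sumTo M (λ i → f i *ℤ c) ≡⟨ sumTo-cong M (λ i _ → ℤ.*-comm (f i) c) ⟩
  sumTo M (λ i → c *ℤ f i) ≡⟨ sumTo-*ˡ M c f ⟩
  c *ℤ sumTo M f           ≡⟨ ℤ.*-comm c _ ⟩
  sumTo M f *ℤ c           ∎

sumTo-sucˡ : ∀ M (f : ℕ → ℤ) → sumTo (suc M) f ≡ f 0 +ℤ sumTo M (f ∘ suc)
sumTo-sucˡ zero    f = refl
sumTo-sucˡ (suc M) f rewrite sumTo-sucˡ M f = ℤ.+-assoc (f 0) _ _

sumTo-pad : ∀ {M M′} (f : ℕ → ℤ) → M ≤ M′ → (∀ i → M < i → f i ≡ 0ℤ) → sumTo M′ f ≡ sumTo M f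
sumTo-pad {M} {M′} f M≤M′ f>M≗0 with m≤n⇒m<n∨m≡n M≤M′
... | inj₂ refl = refl
... | inj₁ (s≤s {n = M′₋₁} M≤M′₋₁) rewrite f>M≗0 (suc M′₋₁) (s≤s M≤M′₋₁) =
  trans (ℤ.+-identityʳ _) (sumTo-pad f M≤M′₋₁ f>M≗0)

sumTo-swap : ∀ M L (h : ℕ → ℕ → ℤ) → sumTo M (λ K → sumTo L (λ k → h k K)) ≡ sumTo L (λ k → sumTo M (h k))
sumTo-swap zero    L h = refl
sumTo-swap (suc M) L h = trans (cong (_+ℤ sumTo L (λ k → h k (suc M))) (sumTo-swap M L h))
                               (sym (sumTo-+ L (λ k → sumTo M (h k)) (λ k → h k (suc M))))

sumTo-triangle : ∀ M (h : ℕ → ℕ → ℤ) →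
  sumTo M (λ k → sumTo k (λ j → h j k)) ≡ sumTo M (λ j → sumTo (M ∸ j) (λ i → h j (j + i)))
sumTo-triangle zero    h = refl
sumTo-triangle (suc M) h = sym (begin
  sumTo (suc M) (λ j → sumTo (suc M ∸ j) (λ i → h j (j + i)))
    ≡⟨ cong₂ _+ℤ_ (sumTo-cong M rowGrows) (cong (λ t → sumTo t (λ i → h (suc M) (suc M + i))) (n∸n≡0 M)) ⟩
  sumTo M (λ j → sumTo (M ∸ j) (λ i → h j (j + i)) +ℤ h j (suc M)) +ℤ h (suc M) (suc M + 0)
    ≡⟨ cong₂ _+ℤ_ (sumTo-+ M _ (λ j → h j (suc M))) (cong (h (suc M)) (+-identityʳ (suc M))) ⟩
  (sumTo M (λ j → sumTo (M ∸ j) (λ i → h j (j + i))) +ℤ sumTo M (λ j → h j (suc M))) +ℤ h (suc M) (suc M)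
    ≡⟨ ℤ.+-assoc (sumTo M (λ j → sumTo (M ∸ j) (λ i → h j (j + i))))
                 (sumTo M (λ j → h j (suc M))) (h (suc M) (suc M)) ⟩
  sumTo M (λ j → sumTo (M ∸ j) (λ i → h j (j + i))) +ℤ sumTo (suc M) (λ j → h j (suc M))
    ≡⟨ cong (_+ℤ sumTo (suc M) (λ j → h j (suc M))) (sym (sumTo-triangle M h)) ⟩
  sumTo (suc M) (λ k → sumTo k (λ j → h j k)) ∎)
  where
  rowGrows : ∀ j → j ≤ M → sumTo (suc M ∸ j) (λ i → h j (j + i)) ≡ sumTo (M ∸ j) (λ i → h j (j + i)) +ℤ h j (suc M)
  rowGrows j j≤M rewrite +-∸-assoc 1 j≤M = cong (λ t → sumTo (M ∸ j) (λ i → h j (j + i)) +ℤ h j t)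
                                                 (trans (+-suc j (M ∸ j)) (cong suc (m+[n∸m]≡n j≤M)))

sumTo-cauchy : ∀ A B (f g : ℕ → ℤ) y → (∀ j → A < j → f j ≡ 0ℤ) → (∀ i → B < i → g i ≡ 0ℤ) →
  sumTo (A + B) (λ k → sumTo k (λ j → f j *ℤ g (k ∸ j)) *ℤ y ^ℤ k)
  ≡ sumTo A (λ j → f j *ℤ y ^ℤ j) *ℤ sumTo B (λ i → g i *ℤ y ^ℤ i)
sumTo-cauchy A B f g y f>A≗0 g>B≗0 = begin
  sumTo (A + B) (λ k → sumTo k (λ j → f j *ℤ g (k ∸ j)) *ℤ y ^ℤ k)
    ≡⟨ sumTo-cong (A + B) (λ k _ → sym (sumTo-*ʳ k (λ j → f j *ℤ g (k ∸ j)) (y ^ℤ k))) ⟩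
  sumTo (A + B) (λ k → sumTo k (λ j → f j *ℤ g (k ∸ j) *ℤ y ^ℤ k))
    ≡⟨ sumTo-triangle (A + B) (λ j k → f j *ℤ g (k ∸ j) *ℤ y ^ℤ k) ⟩
  sumTo (A + B) (λ j → sumTo (A + B ∸ j) (λ i → f j *ℤ g (j + i ∸ j) *ℤ y ^ℤ (j + i)))
    ≡⟨ sumTo-cong (A + B) (λ j _ → row j) ⟩
  sumTo (A + B) (λ j → F j *ℤ G)
    ≡⟨ sumTo-pad (λ j → F j *ℤ G) (m≤m+n A B) (λ j A<j → cong (λ t → t *ℤ y ^ℤ j *ℤ G) (f>A≗0 j A<j)) ⟩
  sumTo A (λ j → F j *ℤ G)
    ≡⟨ sumTo-*ʳ A F G ⟩
  sumTo A F *ℤ G ∎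
  where
  F Gᵢ : ℕ → ℤ
  F  j = f j *ℤ y ^ℤ j
  Gᵢ i = g i *ℤ y ^ℤ i
  G : ℤ
  G = sumTo B Gᵢ
  term : ∀ j i → f j *ℤ g (j + i ∸ j) *ℤ y ^ℤ (j + i) ≡ F j *ℤ Gᵢ i
  term j i rewrite m+n∸m≡n j i | ℤ.^-distribˡ-+-* y j i = regroup (f j) (g i) (y ^ℤ j) (y ^ℤ i)
    where
    regroup : ∀ a b c d → a *ℤ b *ℤ (c *ℤ d) ≡ (a *ℤ c) *ℤ (b *ℤ d)
    regroup = ℤ-solve-∀
  row : ∀ j → sumTo (A + B ∸ j) (λ i → f j *ℤ g (j + i ∸ j) *ℤ y ^ℤ (j + i)) ≡ F j *ℤ G
  row j with ≤-<-connex j A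
  ... | inj₁ j≤A = begin
    sumTo (A + B ∸ j) (λ i → f j *ℤ g (j + i ∸ j) *ℤ y ^ℤ (j + i)) ≡⟨ sumTo-cong (A + B ∸ j) (λ i _ → term j i) ⟩
    sumTo (A + B ∸ j) (λ i → F j *ℤ Gᵢ i)                          ≡⟨ sumTo-*ˡ (A + B ∸ j) (F j) Gᵢ ⟩
    F j *ℤ sumTo (A + B ∸ j) Gᵢ
      ≡⟨ cong (F j *ℤ_) (sumTo-pad Gᵢ B≤ (λ i B<i → cong (_*ℤ y ^ℤ i) (g>B≗0 i B<i))) ⟩
    F j *ℤ G                                                       ∎
    where
    B≤ : B ≤ A + B ∸ j
    B≤ = subst (B ≤_) (sym (+-∸-comm B j≤A)) (m≤n+m B (A ∸ j))
  ... | inj₂ A<j rewrite f>A≗0 j A<j =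
    sumTo-zero (A + B ∸ j) (λ i _ → cong (_*ℤ y ^ℤ (j + i)) (ℤ.*-zeroˡ (g (j + i ∸ j))))

sumToℕ-zero : ∀ M {f : ℕ → ℕ} → (∀ i → i ≤ M → f i ≡ 0) → sumToℕ M f ≡ 0
sumToℕ-zero zero    f≗0 = f≗0 0 z≤n
sumToℕ-zero (suc M) f≗0 rewrite sumToℕ-zero M (λ i i≤M → f≗0 i (m≤n⇒m≤1+n i≤M)) = f≗0 (suc M) ≤-refl

pos-sumToℕ : ∀ M (f : ℕ → ℕ) → + sumToℕ M f ≡ sumTo M (λ i → + f i)
pos-sumToℕ zero    f = refl
pos-sumToℕ (suc M) f = trans (ℤ.pos-+ (sumToℕ M f) (f (suc M))) (cong (_+ℤ + f (suc M)) (pos-sumToℕ M f))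

-- Stirling numbers of the first kind and the coefficients a_k

rising : ℤ → ℕ → ℤ
rising y zero    = 1ℤ
rising y (suc r) = rising y r *ℤ (y +ℤ + r)

falling : ℤ → ℕ → ℤ
falling x zero    = 1ℤ
falling x (suc d) = x *ℤ falling (x -ℤ 1ℤ) d

stirling1-vanishes : ∀ {r j} → r < j → stirling1 r j ≡ 0
stirling1-vanishes {zero}  {suc j} _         = refl
stirling1-vanishes {suc r} {suc j} (s<s r<j)
  rewrite stirling1-vanishes (m<n⇒m<1+n r<j) | stirling1-vanishes r<j = trans (+-identityʳ _) (*-zeroʳ r)

stirling1-rising : ∀ r y → sumTo r (λ j → + stirling1 r j *ℤ y ^ℤ j) ≡ rising y r
stirling1-rising zero    y = refl
stirling1-rising (suc r) y = begin
  sumTo (suc r) (λ j → + stirling1 (suc r) j *ℤ y ^ℤ j)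
    ≡⟨ sumTo-cong (suc r) (λ j _ → recurrence j) ⟩
  sumTo (suc r) (λ j → + r *ℤ term j +ℤ shifted j)
    ≡⟨ sumTo-+ (suc r) (λ j → + r *ℤ term j) shifted ⟩
  sumTo (suc r) (λ j → + r *ℤ term j) +ℤ sumTo (suc r) shifted
    ≡⟨ cong₂ _+ℤ_ (trans (sumTo-*ˡ (suc r) (+ r) term) (cong (+ r *ℤ_) padded)) (sumTo-sucˡ r shifted) ⟩
  + r *ℤ R +ℤ (0ℤ +ℤ sumTo r (λ j → term j *ℤ y))
    ≡⟨ cong (λ t → + r *ℤ R +ℤ (0ℤ +ℤ t)) (trans (sumTo-*ʳ r term y) (cong (_*ℤ y) (stirling1-rising r y))) ⟩
  + r *ℤ R +ℤ (0ℤ +ℤ R *ℤ y)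
    ≡⟨ collect (+ r) y R ⟩
  R *ℤ (y +ℤ + r) ∎
  where
  R : ℤ
  R = rising y r
  term shifted : ℕ → ℤ
  term j = + stirling1 r j *ℤ y ^ℤ j
  shifted zero    = 0ℤ
  shifted (suc j) = term j *ℤ y
  collect : ∀ r y R → r *ℤ R +ℤ (0ℤ +ℤ R *ℤ y) ≡ R *ℤ (y +ℤ r)
  collect = ℤ-solve-∀
  padded : sumTo (suc r) term ≡ R
  padded rewrite stirling1-vanishes (n<1+n r) = trans (ℤ.+-identityʳ _) (stirling1-rising r y)
  recurrence : ∀ j → + stirling1 (suc r) j *ℤ y ^ℤ j ≡ + r *ℤ term j +ℤ shifted j
  recurrence zero = sym (begin
    + r *ℤ (+ stirling1 r 0 *ℤ 1ℤ) +ℤ 0ℤ ≡⟨ ℤ.+-identityʳ _ ⟩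
    + r *ℤ (+ stirling1 r 0 *ℤ 1ℤ)        ≡⟨ cong (+ r *ℤ_) (ℤ.*-identityʳ _) ⟩
    + r *ℤ + stirling1 r 0                ≡⟨ sym (ℤ.pos-* r (stirling1 r 0)) ⟩
    + (r * stirling1 r 0)                 ≡⟨ cong +_ (r*[r,0]≡0 r) ⟩
    0ℤ                                    ∎)
    where
    r*[r,0]≡0 : ∀ r → r * stirling1 r 0 ≡ 0
    r*[r,0]≡0 zero    = refl
    r*[r,0]≡0 (suc r) = *-zeroʳ (suc r)
  recurrence (suc j) =
    trans (cong (_*ℤ y ^ℤ suc j) (trans (ℤ.pos-+ (r * stirling1 r (suc j)) (stirling1 r j))
                                       (cong (_+ℤ + stirling1 r j) (ℤ.pos-* r (stirling1 r (suc j))))))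
          (distribute (+ r) (+ stirling1 r (suc j)) (+ stirling1 r j) y (y ^ℤ j))
    where
    distribute : ∀ a b c y z → (a *ℤ b +ℤ c) *ℤ (y *ℤ z) ≡ a *ℤ (b *ℤ (y *ℤ z)) +ℤ c *ℤ z *ℤ y
    distribute = ℤ-solve-∀

risings fallings : List ℕ → ℤ → ℤ
risings  []       y = 1ℤ
risings  (r ∷ rs) y = rising y r *ℤ risings rs y
fallings []       x = 1ℤ
fallings (r ∷ rs) x = falling x r *ℤ fallings rs x

fallings-++ : ∀ P R x → fallings (P ++ R) x ≡ fallings P x *ℤ fallings R x
fallings-++ []      R x = sym (ℤ.*-identityˡ _)
fallings-++ (r ∷ P) R x = trans (cong (falling x r *ℤ_) (fallings-++ P R x)) (sym (ℤ.*-assoc (falling x r) _ _))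

conv-vanishes : ∀ rs {i} → sum rs < i → conv rs i ≡ 0
conv-vanishes []       {suc i} _   = refl
conv-vanishes (r ∷ rs) {i}     r+rs<i = sumToℕ-zero i vanishes
  where
  vanishes : ∀ j → j ≤ i → stirling1 r j * conv rs (i ∸ j) ≡ 0
  vanishes j _ with ≤-<-connex j r
  ... | inj₂ r<j rewrite stirling1-vanishes r<j = refl
  ... | inj₁ j≤r = trans (cong (stirling1 r j *_) (conv-vanishes rs rs<i∸j)) (*-zeroʳ (stirling1 r j))
    where
    rs<i∸j : sum rs < i ∸ j
    rs<i∸j = ≤-trans (≤-reflexive (sym (m+n∸m≡n j (suc (sum rs)))))
                     (∸-monoˡ-≤ j (≤-trans (+-monoˡ-≤ (suc (sum rs)) j≤r)
                                          (subst (_≤ i) (sym (+-suc r (sum rs))) r+rs<i)))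

conv-risings : ∀ P y → sumTo (sum P) (λ k → + conv P k *ℤ y ^ℤ k) ≡ risings P y
conv-risings []       y = refl
conv-risings (r ∷ rs) y = begin
  sumTo (r + sum rs) (λ k → + conv (r ∷ rs) k *ℤ y ^ℤ k)
    ≡⟨ sumTo-cong (r + sum rs) (λ k _ → cong (_*ℤ y ^ℤ k) (convolution k)) ⟩
  sumTo (r + sum rs) (λ k → sumTo k (λ j → + stirling1 r j *ℤ + conv rs (k ∸ j)) *ℤ y ^ℤ k)
    ≡⟨ sumTo-cauchy r (sum rs) (λ j → + stirling1 r j) (λ i → + conv rs i) y
         (λ j r<j → cong +_ (stirling1-vanishes r<j)) (λ i rs<i → cong +_ (conv-vanishes rs rs<i)) ⟩
  sumTo r (λ j → + stirling1 r j *ℤ y ^ℤ j) *ℤ sumTo (sum rs) (λ i → + conv rs i *ℤ y ^ℤ i)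
    ≡⟨ cong₂ _*ℤ_ (stirling1-rising r y) (conv-risings rs y) ⟩
  rising y r *ℤ risings rs y ∎
  where
  convolution : ∀ k → + conv (r ∷ rs) k ≡ sumTo k (λ j → + stirling1 r j *ℤ + conv rs (k ∸ j))
  convolution k = trans (pos-sumToℕ k _) (sumTo-cong k (λ j _ → ℤ.pos-* (stirling1 r j) (conv rs (k ∸ j))))

signPow-+ : ∀ a b → signPow (a + b) ≡ signPow a *ℤ signPow b
signPow-+ zero    b = sym (ℤ.*-identityˡ _)
signPow-+ (suc a) b = trans (cong -_ (signPow-+ a b)) (ℤ.neg-distribˡ-* (signPow a) (signPow b))

signPow-square : ∀ k → signPow k *ℤ signPow k ≡ 1ℤ
signPow-square zero    = refl
signPow-square (suc k) = trans (negSquare (signPow k)) (signPow-square k)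
  where
  negSquare : ∀ s → (- s) *ℤ (- s) ≡ s *ℤ s
  negSquare = ℤ-solve-∀

neg-^ : ∀ x k → (- x) ^ℤ k ≡ signPow k *ℤ x ^ℤ k
neg-^ x zero    = refl
neg-^ x (suc k) = trans (cong ((- x) *ℤ_) (neg-^ x k)) (swapSign x (signPow k) (x ^ℤ k))
  where
  swapSign : ∀ x s p → (- x) *ℤ (s *ℤ p) ≡ (- s) *ℤ (x *ℤ p)
  swapSign = ℤ-solve-∀

falling-sucʳ : ∀ r x → falling x (suc r) ≡ falling x r *ℤ (x -ℤ + r)
falling-sucʳ zero    x = trans (ℤ.*-identityʳ x) (sym (trans (ℤ.*-identityˡ _) (ℤ.+-identityʳ x)))
falling-sucʳ (suc r) x = begin
  x *ℤ falling (x -ℤ 1ℤ) (suc r)               ≡⟨ cong (x *ℤ_) (falling-sucʳ r (x -ℤ 1ℤ)) ⟩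
  x *ℤ (falling (x -ℤ 1ℤ) r *ℤ (x -ℤ 1ℤ -ℤ + r)) ≡⟨ cong (λ t → x *ℤ (falling (x -ℤ 1ℤ) r *ℤ t)) (shift x (+ r)) ⟩
  x *ℤ (falling (x -ℤ 1ℤ) r *ℤ (x -ℤ (1ℤ +ℤ + r))) ≡⟨ sym (ℤ.*-assoc x _ _) ⟩
  falling x (suc r) *ℤ (x -ℤ + suc r)           ∎
  where
  shift : ∀ x r → x -ℤ 1ℤ -ℤ r ≡ x -ℤ (1ℤ +ℤ r)
  shift = ℤ-solve-∀

signPow-rising : ∀ r x → signPow r *ℤ rising (- x) r ≡ falling x r
signPow-rising zero    x = refl
signPow-rising (suc r) x = begin
  (- signPow r) *ℤ (rising (- x) r *ℤ ((- x) +ℤ + r)) ≡⟨ regroup (signPow r) (rising (- x) r) x (+ r) ⟩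
  (signPow r *ℤ rising (- x) r) *ℤ (x -ℤ + r)         ≡⟨ cong (_*ℤ (x -ℤ + r)) (signPow-rising r x) ⟩
  falling x r *ℤ (x -ℤ + r)                           ≡⟨ sym (falling-sucʳ r x) ⟩
  falling x (suc r)                                   ∎
  where
  regroup : ∀ s f x r → (- s) *ℤ (f *ℤ ((- x) +ℤ r)) ≡ (s *ℤ f) *ℤ (x -ℤ r)
  regroup = ℤ-solve-∀

signPow-risings : ∀ P x → signPow (sum P) *ℤ risings P (- x) ≡ fallings P x
signPow-risings []       x = refl
signPow-risings (r ∷ rs) x = begin
  signPow (r + sum rs) *ℤ (rising (- x) r *ℤ risings rs (- x))
    ≡⟨ cong (_*ℤ (rising (- x) r *ℤ risings rs (- x))) (signPow-+ r (sum rs)) ⟩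
  signPow r *ℤ signPow (sum rs) *ℤ (rising (- x) r *ℤ risings rs (- x))
    ≡⟨ interchange (signPow r) (signPow (sum rs)) (rising (- x) r) (risings rs (- x)) ⟩
  (signPow r *ℤ rising (- x) r) *ℤ (signPow (sum rs) *ℤ risings rs (- x))
    ≡⟨ cong₂ _*ℤ_ (signPow-rising r x) (signPow-risings rs x) ⟩
  falling x r *ℤ fallings rs x ∎
  where
  interchange : ∀ a b c d → a *ℤ b *ℤ (c *ℤ d) ≡ (a *ℤ c) *ℤ (b *ℤ d)
  interchange = ℤ-solve-∀

aCoeff-fallings : ∀ P x → sumTo (sum P) (λ k → aCoeff P k *ℤ x ^ℤ k) ≡ fallings P x
aCoeff-fallings P x = begin
  sumTo (sum P) (λ k → aCoeff P k *ℤ x ^ℤ k)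
    ≡⟨ sumTo-cong (sum P) (λ k k≤P → signSplit k k≤P) ⟩
  sumTo (sum P) (λ k → signPow (sum P) *ℤ (+ conv P k *ℤ (- x) ^ℤ k))
    ≡⟨ sumTo-*ˡ (sum P) (signPow (sum P)) _ ⟩
  signPow (sum P) *ℤ sumTo (sum P) (λ k → + conv P k *ℤ (- x) ^ℤ k)
    ≡⟨ cong (signPow (sum P) *ℤ_) (conv-risings P (- x)) ⟩
  signPow (sum P) *ℤ risings P (- x)
    ≡⟨ signPow-risings P x ⟩
  fallings P x ∎
  where
  -- (−1)^{|P|−k} = (−1)^{|P|} (−1)^k needs k ≤ |P|, as ∸ truncates.
  signSplit : ∀ k → k ≤ sum P → aCoeff P k *ℤ x ^ℤ k ≡ signPow (sum P) *ℤ (+ conv P k *ℤ (- x) ^ℤ k)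
  signSplit k k≤P = sym (begin
    signPow (sum P) *ℤ (+ conv P k *ℤ (- x) ^ℤ k)
      ≡⟨ cong₂ (λ s t → s *ℤ (+ conv P k *ℤ t))
               (trans (cong signPow (sym (m∸n+n≡m k≤P))) (signPow-+ (sum P ∸ k) k)) (neg-^ x k) ⟩
    signPow (sum P ∸ k) *ℤ signPow k *ℤ (+ conv P k *ℤ (signPow k *ℤ x ^ℤ k))
      ≡⟨ regroup (signPow (sum P ∸ k)) (signPow k) (+ conv P k) (x ^ℤ k) ⟩
    signPow (sum P ∸ k) *ℤ + conv P k *ℤ (signPow k *ℤ signPow k) *ℤ x ^ℤ k
      ≡⟨ cong (λ t → aCoeff P k *ℤ t *ℤ x ^ℤ k) (signPow-square k) ⟩
    aCoeff P k *ℤ 1ℤ *ℤ x ^ℤ k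
      ≡⟨ cong (_*ℤ x ^ℤ k) (ℤ.*-identityʳ (aCoeff P k)) ⟩
    aCoeff P k *ℤ x ^ℤ k ∎)
    where
    regroup : ∀ a s c X → a *ℤ s *ℤ (c *ℤ (s *ℤ X)) ≡ a *ℤ c *ℤ (s *ℤ s) *ℤ X
    regroup = ℤ-solve-∀

-- Falling-factorial expansion of restricted Stirling numbers

fallingSum : ℕ → ℕ → (ℕ → ℕ) → ℤ → ℤ
fallingSum N next g x = sumTo N (λ d → + g (next + d) *ℤ falling (x -ℤ + next) d)

minus-suc : ∀ x n → x -ℤ + n -ℤ 1ℤ ≡ x -ℤ + suc n
minus-suc x n = sub-assoc x (+ n)
  where
  sub-assoc : ∀ x m → x -ℤ m -ℤ 1ℤ ≡ x -ℤ (1ℤ +ℤ m)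
  sub-assoc = ℤ-solve-∀

fallingSum-linear : ∀ N next c (A B : ℕ → ℕ) x →
  fallingSum N next (λ K → c * A K + B K) x ≡ + c *ℤ fallingSum N next A x +ℤ fallingSum N next B x
fallingSum-linear N next c A B x = begin
  fallingSum N next (λ K → c * A K + B K) x
    ≡⟨ sumTo-cong N (λ d _ → split d) ⟩
  sumTo N (λ d → + c *ℤ a d +ℤ b d)
    ≡⟨ sumTo-+ N (λ d → + c *ℤ a d) b ⟩
  sumTo N (λ d → + c *ℤ a d) +ℤ sumTo N b
    ≡⟨ cong (_+ℤ sumTo N b) (sumTo-*ˡ N (+ c) a) ⟩
  + c *ℤ fallingSum N next A x +ℤ fallingSum N next B x ∎
  where
  y : ℤ
  y = x -ℤ + next
  a b : ℕ → ℤ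
  a d = + A (next + d) *ℤ falling y d
  b d = + B (next + d) *ℤ falling y d
  distribute : ∀ p q r f → (p *ℤ q +ℤ r) *ℤ f ≡ p *ℤ (q *ℤ f) +ℤ r *ℤ f
  distribute = ℤ-solve-∀
  split : ∀ d → + (c * A (next + d) + B (next + d)) *ℤ falling y d ≡ + c *ℤ a d +ℤ b d
  split d = trans (cong (_*ℤ falling y d) (trans (ℤ.pos-+ (c * A (next + d)) _) (cong (_+ℤ _) (ℤ.pos-* c _))))
                  (distribute (+ c) (+ A (next + d)) (+ B (next + d)) (falling y d))

fallingSum-sucᵗᵒᵖ : ∀ N next (A : ℕ → ℕ) x → A (next + suc N) ≡ 0 →
  fallingSum (suc N) next A x ≡ fallingSum N next A x
fallingSum-sucᵗᵒᵖ N next A x A-top rewrite A-top = ℤ.+-identityʳ _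

fallingSum-open : ∀ N next (B : ℕ → ℕ) x → B next ≡ 0 →
  fallingSum (suc N) next B x ≡ (x -ℤ + next) *ℤ fallingSum N (suc next) B x
fallingSum-open N next B x B-bottom = begin
  sumTo (suc N) b                   ≡⟨ sumTo-sucˡ N b ⟩
  b 0 +ℤ sumTo N (b ∘ suc)          ≡⟨ cong₂ _+ℤ_ b₀≡0 (sumTo-cong N (λ d _ → peel d)) ⟩
  0ℤ +ℤ sumTo N (λ d → y *ℤ b′ d)   ≡⟨ ℤ.+-identityˡ _ ⟩
  sumTo N (λ d → y *ℤ b′ d)         ≡⟨ sumTo-*ˡ N y b′ ⟩
  y *ℤ sumTo N b′                   ∎
  where
  y : ℤ
  y = x -ℤ + next
  b b′ : ℕ → ℤ
  b  d = + B (next + d) *ℤ falling y d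
  b′ d = + B (suc next + d) *ℤ falling (x -ℤ + suc next) d
  b₀≡0 : b 0 ≡ 0ℤ
  b₀≡0 rewrite +-identityʳ next | B-bottom = refl
  swap : ∀ p q r → p *ℤ (q *ℤ r) ≡ q *ℤ (p *ℤ r)
  swap = ℤ-solve-∀
  peel : ∀ d → b (suc d) ≡ y *ℤ b′ d
  peel d rewrite +-suc next d | minus-suc x next = swap (+ B (suc next + d)) y (falling (x -ℤ + suc next) d)

fallingSum-step : ∀ N next c (A B : ℕ → ℕ) x → A (next + suc N) ≡ 0 → B next ≡ 0 →
  fallingSum (suc N) next (λ K → c * A K + B K) x
  ≡ + c *ℤ fallingSum N next A x +ℤ (x -ℤ + next) *ℤ fallingSum N (suc next) B x
fallingSum-step N next c A B x A-top B-bottom =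
  trans (fallingSum-linear (suc N) next c A B x)
        (cong₂ (λ p q → + c *ℤ p +ℤ q) (fallingSum-sucᵗᵒᵖ N next A x A-top) (fallingSum-open N next B x B-bottom))

-- The number of colourings of N further elements with x colours in which every segment is rainbow,
-- when u colours are already used in the current segment.
colourings : (N u a : ℕ) → List ℕ → ℤ → ℤ
colourings zero    u a       s       x = 1ℤ
colourings (suc N) u zero    []      x = x *ℤ colourings N 0 0 [] x
colourings (suc N) u zero    (b ∷ s) x = colourings (suc N) 0 b s x
colourings (suc N) u (suc a) s       x = (x -ℤ + u) *ℤ colourings N (suc u) a s x

extensions-fallingSum : ∀ N next u a s x → u ≤ next →
  fallingSum N next (extensions N next u a s) x ≡ colourings N u a s x
extensions-fallingSum zero next u a s x _ rewrite +-identityʳ next | ≡ᵇ-refl next = refl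
extensions-fallingSum (suc N) next u zero (b ∷ s) x _ = extensions-fallingSum (suc N) next 0 b s x z≤n
extensions-fallingSum (suc N) next u zero [] x _ = begin
  fallingSum (suc N) next (extensions (suc N) next u 0 []) x
    ≡⟨ fallingSum-step N next next (extensions N next 0 0 []) (extensions N (suc next) 0 0 []) x
         (extensions-> N 0 0 [] (≤-reflexive (sym (+-suc next N)))) (extensions-< N 0 0 [] (n<1+n next)) ⟩
  + next *ℤ fallingSum N next (extensions N next 0 0 []) x
    +ℤ (x -ℤ + next) *ℤ fallingSum N (suc next) (extensions N (suc next) 0 0 []) x
    ≡⟨ cong₂ (λ p q → + next *ℤ p +ℤ (x -ℤ + next) *ℤ q)
             (extensions-fallingSum N next 0 0 [] x z≤n) (extensions-fallingSum N (suc next) 0 0 [] x z≤n) ⟩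
  + next *ℤ C +ℤ (x -ℤ + next) *ℤ C
    ≡⟨ collect (+ next) x C ⟩
  x *ℤ C ∎
  where
  C : ℤ
  C = colourings N 0 0 [] x
  collect : ∀ n x c → n *ℤ c +ℤ (x -ℤ n) *ℤ c ≡ x *ℤ c
  collect = ℤ-solve-∀
extensions-fallingSum (suc N) next u (suc a) s x u≤next = begin
  fallingSum (suc N) next (extensions (suc N) next u (suc a) s) x
    ≡⟨ fallingSum-step N next (next ∸ u) (extensions N next (suc u) a s) (extensions N (suc next) (suc u) a s) x
         (extensions-> N (suc u) a s (≤-reflexive (sym (+-suc next N)))) (extensions-< N (suc u) a s (n<1+n next)) ⟩
  + (next ∸ u) *ℤ fallingSum N next (extensions N next (suc u) a s) x
    +ℤ (x -ℤ + next) *ℤ fallingSum N (suc next) (extensions N (suc next) (suc u) a s) x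
    ≡⟨ cong (λ q → + (next ∸ u) *ℤ fallingSum N next (extensions N next (suc u) a s) x +ℤ (x -ℤ + next) *ℤ q)
            (extensions-fallingSum N (suc next) (suc u) a s x (s≤s u≤next)) ⟩
  + (next ∸ u) *ℤ fallingSum N next (extensions N next (suc u) a s) x +ℤ (x -ℤ + next) *ℤ C
    ≡⟨ reusedBlocks (m≤n⇒m<n∨m≡n u≤next) ⟩
  (x -ℤ + u) *ℤ C ∎
  where
  C : ℤ
  C = colourings N (suc u) a s x
  collect : ∀ n u x c → (n -ℤ u) *ℤ c +ℤ (x -ℤ n) *ℤ c ≡ (x -ℤ u) *ℤ c
  collect = ℤ-solve-∀
  reusedBlocks : u < next ⊎ u ≡ next →
    + (next ∸ u) *ℤ fallingSum N next (extensions N next (suc u) a s) x +ℤ (x -ℤ + next) *ℤ C ≡ (x -ℤ + u) *ℤ C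
  reusedBlocks (inj₁ u<next) = begin
    + (next ∸ u) *ℤ fallingSum N next (extensions N next (suc u) a s) x +ℤ (x -ℤ + next) *ℤ C
      ≡⟨ cong₂ (λ p q → p *ℤ q +ℤ (x -ℤ + next) *ℤ C)
               (sym (trans (ℤ.[+m]-[+n]≡m⊖n next u) (ℤ.⊖-≥ u≤next)))
               (extensions-fallingSum N next (suc u) a s x u<next) ⟩
    (+ next -ℤ + u) *ℤ C +ℤ (x -ℤ + next) *ℤ C
      ≡⟨ collect (+ next) (+ u) x C ⟩
    (x -ℤ + u) *ℤ C ∎
  reusedBlocks (inj₂ refl) rewrite n∸n≡0 u = ℤ.+-identityˡ _

colourings-segmentStart : ∀ N u s x → colourings N u 0 s x ≡ colourings N 0 0 s x
colourings-segmentStart zero    u s       x = refl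
colourings-segmentStart (suc N) u []      x = refl
colourings-segmentStart (suc N) u (b ∷ s) x = refl

colourings-nextSegment : ∀ N b s x → colourings N 0 0 (b ∷ s) x ≡ colourings N 0 b s x
colourings-nextSegment zero    b s x = refl
colourings-nextSegment (suc N) b s x = refl

colourings-segment : ∀ a M u s x → colourings (a + M) u a s x ≡ falling (x -ℤ + u) a *ℤ colourings M 0 0 s x
colourings-segment zero    M u s x = trans (colourings-segmentStart M u s x) (sym (ℤ.*-identityˡ _))
colourings-segment (suc a) M u s x = begin
  (x -ℤ + u) *ℤ colourings (a + M) (suc u) a s x
    ≡⟨ cong ((x -ℤ + u) *ℤ_) (colourings-segment a M (suc u) s x) ⟩
  (x -ℤ + u) *ℤ (falling (x -ℤ + suc u) a *ℤ colourings M 0 0 s x)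
    ≡⟨ cong (λ t → (x -ℤ + u) *ℤ (falling t a *ℤ colourings M 0 0 s x)) (sym (minus-suc x u)) ⟩
  (x -ℤ + u) *ℤ (falling (x -ℤ + u -ℤ 1ℤ) a *ℤ colourings M 0 0 s x)
    ≡⟨ sym (ℤ.*-assoc (x -ℤ + u) _ _) ⟩
  falling (x -ℤ + u) (suc a) *ℤ colourings M 0 0 s x ∎

colourings-unrestricted : ∀ n x → colourings n 0 0 [] x ≡ x ^ℤ n
colourings-unrestricted zero    x = refl
colourings-unrestricted (suc n) x = cong (x *ℤ_) (colourings-unrestricted n x)

colourings-fallings : ∀ s n x → colourings (sum s + n) 0 0 s x ≡ fallings s x *ℤ x ^ℤ n
colourings-fallings []      n x = trans (colourings-unrestricted n x) (sym (ℤ.*-identityˡ _))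
colourings-fallings (b ∷ s) n x = begin
  colourings (b + sum s + n) 0 0 (b ∷ s) x    ≡⟨ cong (λ t → colourings t 0 0 (b ∷ s) x) (+-assoc b (sum s) n) ⟩
  colourings (b + (sum s + n)) 0 0 (b ∷ s) x  ≡⟨ colourings-nextSegment (b + (sum s + n)) b s x ⟩
  colourings (b + (sum s + n)) 0 b s x        ≡⟨ colourings-segment b (sum s + n) 0 s x ⟩
  falling (x -ℤ 0ℤ) b *ℤ colourings (sum s + n) 0 0 s x
    ≡⟨ cong₂ (λ t c → falling t b *ℤ c) (ℤ.+-identityʳ x) (colourings-fallings s n x) ⟩
  falling x b *ℤ (fallings s x *ℤ x ^ℤ n)     ≡⟨ sym (ℤ.*-assoc (falling x b) _ _) ⟩
  fallings (b ∷ s) x *ℤ x ^ℤ n                ∎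

StirlingR-fallings : ∀ n s x M → n + sum s ≤ M →
  sumTo M (λ K → + StirlingR (n + sum s) K s *ℤ falling x K) ≡ fallings s x *ℤ x ^ℤ n
StirlingR-fallings n s x M N≤M = begin
  sumTo M (λ K → + StirlingR N K s *ℤ falling x K)
    ≡⟨ sumTo-pad (λ K → + StirlingR N K s *ℤ falling x K) N≤M
                 (λ K N<K → cong (λ t → + t *ℤ falling x K) (StirlingR-vanishes s N<K)) ⟩
  sumTo N (λ K → + StirlingR N K s *ℤ falling x K)
    ≡⟨ sumTo-cong N (λ K _ → cong₂ (λ c t → + c *ℤ falling t K) (StirlingR≡extensions N K s) (sym (ℤ.+-identityʳ x))) ⟩
  fallingSum N 0 (extensions N 0 0 0 s) x
    ≡⟨ extensions-fallingSum N 0 0 0 s x z≤n ⟩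
  colourings N 0 0 s x
    ≡⟨ cong (λ t → colourings t 0 0 s x) (+-comm n (sum s)) ⟩
  colourings (sum s + n) 0 0 s x
    ≡⟨ colourings-fallings s n x ⟩
  fallings s x *ℤ x ^ℤ n ∎
  where
  N : ℕ
  N = n + sum s

-- The falling factorials are linearly independent

falling-vanishes : ∀ {K i} → K < i → falling (+ K) i ≡ 0ℤ
falling-vanishes {zero}  {suc i} _         = refl
falling-vanishes {suc K} {suc i} (s<s K<i) = trans (cong (+ suc K *ℤ_) (falling-vanishes K<i)) (ℤ.*-zeroʳ (+ suc K))

falling-nonzero : ∀ K → falling (+ K) K ≢ 0ℤ
falling-nonzero zero    ()
falling-nonzero (suc K) eq with ℤ.i*j≡0⇒i≡0∨j≡0 (+ suc K) eq
... | inj₂ eq′ = falling-nonzero K eq′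

sumTo-single : ∀ M (f : ℕ → ℤ) K → K ≤ M → (∀ i → i ≤ M → i ≢ K → f i ≡ 0ℤ) → sumTo M f ≡ f K
sumTo-single zero    f zero    z≤n _      = refl
sumTo-single (suc M) f K K≤1+M others with m≤n⇒m<n∨m≡n K≤1+M
... | inj₁ (s≤s K≤M) = begin
  sumTo M f +ℤ f (suc M) ≡⟨ cong₂ _+ℤ_ (sumTo-single M f K K≤M (λ i i≤M → others i (m≤n⇒m≤1+n i≤M)))
                                       (others (suc M) ≤-refl (>⇒≢ (s≤s K≤M))) ⟩
  f K +ℤ 0ℤ              ≡⟨ ℤ.+-identityʳ (f K) ⟩
  f K                    ∎
... | inj₂ refl = trans (cong (_+ℤ f (suc M)) (sumTo-zero M (λ i i≤M → others i (m≤n⇒m≤1+n i≤M) (<⇒≢ (s≤s i≤M)))))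
                        (ℤ.+-identityˡ (f (suc M)))

fallingBasis-zero : ∀ M (c : ℕ → ℤ) → (∀ n → sumTo M (λ K → c K *ℤ falling (+ n) K) ≡ 0ℤ) →
  ∀ K → K ≤ M → c K ≡ 0ℤ
fallingBasis-zero M c vanish = <-rec (λ K → K ≤ M → c K ≡ 0ℤ) step
  where
  step : ∀ K → (∀ {i} → i < K → i ≤ M → c i ≡ 0ℤ) → K ≤ M → c K ≡ 0ℤ
  step K below K≤M with ℤ.i*j≡0⇒i≡0∨j≡0 (c K) (trans (sym (sumTo-single M _ K K≤M others)) (vanish K))
    where
    others : ∀ i → i ≤ M → i ≢ K → c i *ℤ falling (+ K) i ≡ 0ℤ
    others i i≤M i≢K with <-cmp i K
    ... | tri< i<K _ _ = cong (_*ℤ falling (+ K) i) (below i<K i≤M)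
    ... | tri≈ _ i≡K _ = contradiction i≡K i≢K
    ... | tri> _ _ K<i = trans (cong (c i *ℤ_) (falling-vanishes K<i)) (ℤ.*-zeroʳ (c i))
  ... | inj₁ cK≡0 = cK≡0
  ... | inj₂ eq   = contradiction eq (falling-nonzero K)

fallingBasis-injective : ∀ M (c d : ℕ → ℤ) →
  (∀ n → sumTo M (λ K → c K *ℤ falling (+ n) K) ≡ sumTo M (λ K → d K *ℤ falling (+ n) K)) →
  ∀ K → K ≤ M → c K ≡ d K
fallingBasis-injective M c d agree K K≤M =
  ℤ.i-j≡0⇒i≡j (c K) (d K) (fallingBasis-zero M (λ K → c K -ℤ d K) difference K K≤M)
  where
  difference : ∀ n → sumTo M (λ K → (c K -ℤ d K) *ℤ falling (+ n) K) ≡ 0ℤ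
  difference n = begin
    sumTo M (λ K → (c K -ℤ d K) *ℤ falling (+ n) K)
      ≡⟨ sumTo-cong M (λ K _ → expand (c K) (d K) (falling (+ n) K)) ⟩
    sumTo M (λ K → c K *ℤ falling (+ n) K +ℤ -1ℤ *ℤ (d K *ℤ falling (+ n) K))
      ≡⟨ sumTo-+ M _ _ ⟩
    sumTo M (λ K → c K *ℤ falling (+ n) K) +ℤ sumTo M (λ K → -1ℤ *ℤ (d K *ℤ falling (+ n) K))
      ≡⟨ cong₂ _+ℤ_ (agree n) (sumTo-*ˡ M -1ℤ _) ⟩
    S +ℤ -1ℤ *ℤ S
      ≡⟨ cancel S ⟩
    0ℤ ∎
    where
    S : ℤ
    S = sumTo M (λ K → d K *ℤ falling (+ n) K)
    expand : ∀ a b f → (a -ℤ b) *ℤ f ≡ a *ℤ f +ℤ -1ℤ *ℤ (b *ℤ f)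
    expand = ℤ-solve-∀
    cancel : ∀ s → s +ℤ -1ℤ *ℤ s ≡ 0ℤ
    cancel = ℤ-solve-∀

-- The recurrence for B_n

aCoeff-StirlingR-fallings : ∀ n P R x M → n + sum (P ++ R) ≤ M →
  sumTo M (λ K → sumTo (sum P) (λ k → aCoeff P k *ℤ + StirlingR (n + k + sum R) K R) *ℤ falling x K)
  ≡ fallings P x *ℤ (fallings R x *ℤ x ^ℤ n)
aCoeff-StirlingR-fallings n P R x M N≤M = begin
  sumTo M (λ K → sumTo (sum P) (λ k → aCoeff P k *ℤ + S k K) *ℤ falling x K)
    ≡⟨ sumTo-cong M (λ K _ → sym (sumTo-*ʳ (sum P) (λ k → aCoeff P k *ℤ + S k K) (falling x K))) ⟩
  sumTo M (λ K → sumTo (sum P) (λ k → aCoeff P k *ℤ + S k K *ℤ falling x K))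
    ≡⟨ sumTo-swap M (sum P) (λ k K → aCoeff P k *ℤ + S k K *ℤ falling x K) ⟩
  sumTo (sum P) (λ k → sumTo M (λ K → aCoeff P k *ℤ + S k K *ℤ falling x K))
    ≡⟨ sumTo-cong (sum P) row ⟩
  sumTo (sum P) (λ k → (fallings R x *ℤ x ^ℤ n) *ℤ (aCoeff P k *ℤ x ^ℤ k))
    ≡⟨ sumTo-*ˡ (sum P) (fallings R x *ℤ x ^ℤ n) _ ⟩
  (fallings R x *ℤ x ^ℤ n) *ℤ sumTo (sum P) (λ k → aCoeff P k *ℤ x ^ℤ k)
    ≡⟨ cong ((fallings R x *ℤ x ^ℤ n) *ℤ_) (aCoeff-fallings P x) ⟩
  (fallings R x *ℤ x ^ℤ n) *ℤ fallings P x
    ≡⟨ ℤ.*-comm (fallings R x *ℤ x ^ℤ n) (fallings P x) ⟩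
  fallings P x *ℤ (fallings R x *ℤ x ^ℤ n) ∎
  where
  S : ℕ → ℕ → ℕ
  S k K = StirlingR (n + k + sum R) K R
  regroup : ∀ a f u v → a *ℤ (f *ℤ (u *ℤ v)) ≡ (f *ℤ u) *ℤ (a *ℤ v)
  regroup = ℤ-solve-∀
  row : ∀ k → k ≤ sum P →
    sumTo M (λ K → aCoeff P k *ℤ + S k K *ℤ falling x K) ≡ (fallings R x *ℤ x ^ℤ n) *ℤ (aCoeff P k *ℤ x ^ℤ k)
  row k k≤P = begin
    sumTo M (λ K → aCoeff P k *ℤ + S k K *ℤ falling x K)
      ≡⟨ sumTo-cong M (λ K _ → ℤ.*-assoc (aCoeff P k) _ _) ⟩
    sumTo M (λ K → aCoeff P k *ℤ (+ S k K *ℤ falling x K))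
      ≡⟨ sumTo-*ˡ M (aCoeff P k) _ ⟩
    aCoeff P k *ℤ sumTo M (λ K → + S k K *ℤ falling x K)
      ≡⟨ cong (aCoeff P k *ℤ_) (StirlingR-fallings (n + k) R x M fits) ⟩
    aCoeff P k *ℤ (fallings R x *ℤ x ^ℤ (n + k))
      ≡⟨ cong (λ t → aCoeff P k *ℤ (fallings R x *ℤ t)) (ℤ.^-distribˡ-+-* x n k) ⟩
    aCoeff P k *ℤ (fallings R x *ℤ (x ^ℤ n *ℤ x ^ℤ k))
      ≡⟨ regroup (aCoeff P k) (fallings R x) (x ^ℤ n) (x ^ℤ k) ⟩
    (fallings R x *ℤ x ^ℤ n) *ℤ (aCoeff P k *ℤ x ^ℤ k) ∎
    where
    fits : n + k + sum R ≤ M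
    fits = ≤-trans (+-monoˡ-≤ (sum R) (+-monoʳ-≤ n k≤P))
                   (≤-trans (≤-reflexive (trans (+-assoc n (sum P) (sum R)) (cong (_+_ n) (sym (sum-++ P R))))) N≤M)

StirlingR-++ : ∀ n P R K → + StirlingR (n + sum (P ++ R)) K (P ++ R)
  ≡ sumTo (sum P) (λ k → aCoeff P k *ℤ + StirlingR (n + k + sum R) K R)
StirlingR-++ n P R K = fallingBasis-injective M lhs rhs agree K (m≤n+m K N)
  where
  N M : ℕ
  N = n + sum (P ++ R)
  M = N + K
  lhs rhs : ℕ → ℤ
  lhs K′ = + StirlingR N K′ (P ++ R)
  rhs K′ = sumTo (sum P) (λ k → aCoeff P k *ℤ + StirlingR (n + k + sum R) K′ R)
  agree : ∀ m → sumTo M (λ K′ → lhs K′ *ℤ falling (+ m) K′) ≡ sumTo M (λ K′ → rhs K′ *ℤ falling (+ m) K′)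
  agree m = begin
    sumTo M (λ K′ → lhs K′ *ℤ falling x K′)  ≡⟨ StirlingR-fallings n (P ++ R) x M (m≤m+n N K) ⟩
    fallings (P ++ R) x *ℤ x ^ℤ n            ≡⟨ cong (_*ℤ x ^ℤ n) (fallings-++ P R x) ⟩
    fallings P x *ℤ fallings R x *ℤ x ^ℤ n   ≡⟨ ℤ.*-assoc (fallings P x) _ _ ⟩
    fallings P x *ℤ (fallings R x *ℤ x ^ℤ n) ≡⟨ sym (aCoeff-StirlingR-fallings n P R x M (m≤m+n N K)) ⟩
    sumTo M (λ K′ → rhs K′ *ℤ falling x K′)  ∎
    where
    x : ℤ
    x = + m

splitLast-sum : ∀ s → sum (proj₁ (splitLast s)) + proj₂ (splitLast s) ≡ sum s
splitLast-sum []           = refl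
splitLast-sum (x ∷ [])     = sym (+-identityʳ x)
splitLast-sum (x ∷ y ∷ xs) with splitLast (y ∷ xs) | splitLast-sum (y ∷ xs)
... | is , l | sum≡ = trans (+-assoc x (sum is) l) (cong (_+_ x) sum≡)

initS-lastS-sum : ∀ s → sum (initS s) + lastS s ≡ sum s
initS-lastS-sum s with splitLast s | splitLast-sum s
... | is , l | sum≡ = sum≡

lastS-∷ : ∀ x y ys → lastS (x ∷ y ∷ ys) ≡ lastS (y ∷ ys)
lastS-∷ x y ys with splitLast (y ∷ ys)
... | is , l = refl

lastS-++ : ∀ P y ys → lastS (P ++ y ∷ ys) ≡ lastS (y ∷ ys)
lastS-++ []          y ys = refl
lastS-++ (x ∷ [])    y ys = lastS-∷ x y ys
lastS-++ (x ∷ z ∷ P) y ys = trans (lastS-∷ x z (P ++ y ∷ ys)) (lastS-++ (z ∷ P) y ys)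

Bcoeff≡StirlingR : ∀ n s j → Bcoeff n s j ≡ StirlingR (n + sum s) (j + lastS s) s
Bcoeff≡StirlingR n s j with j ≤ᵇ (n + sum (initS s)) in j≤ᵇtop
... | true  = refl
... | false = sym (StirlingR-vanishes s beyondTop)
  where
  beyondTop : n + sum s < j + lastS s
  beyondTop = subst (_< j + lastS s) (trans (+-assoc n (sum (initS s)) (lastS s)) (cong (_+_ n) (initS-lastS-sum s)))
                    (+-monoˡ-< (lastS s) (≰⇒> (λ j≤top → subst T j≤ᵇtop (≤⇒≤ᵇ j≤top))))

Bcoeff-++ : ∀ n P R j → 0 < length R →
  + Bcoeff n (P ++ R) j ≡ sumTo (sum P) (λ k → aCoeff P k *ℤ + Bcoeff (n + k) R j)
Bcoeff-++ n P (y ∷ ys) j _ = begin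
  + Bcoeff n (P ++ R) j
    ≡⟨ cong +_ (Bcoeff≡StirlingR n (P ++ R) j) ⟩
  + StirlingR (n + sum (P ++ R)) (j + lastS (P ++ R)) (P ++ R)
    ≡⟨ cong (λ l → + StirlingR (n + sum (P ++ R)) (j + l) (P ++ R)) (lastS-++ P y ys) ⟩
  + StirlingR (n + sum (P ++ R)) (j + lastS R) (P ++ R)
    ≡⟨ StirlingR-++ n P R (j + lastS R) ⟩
  sumTo (sum P) (λ k → aCoeff P k *ℤ + StirlingR (n + k + sum R) (j + lastS R) R)
    ≡⟨ sumTo-cong (sum P) (λ k _ → cong (λ b → aCoeff P k *ℤ + b) (sym (Bcoeff≡StirlingR (n + k) R j))) ⟩
  sumTo (sum P) (λ k → aCoeff P k *ℤ + Bcoeff (n + k) R j) ∎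
  where
  R : List ℕ
  R = y ∷ ys

Bcoeff-take-drop : ∀ n m r j → m < length r →
  + Bcoeff n r j ≡ sumTo (sum (take m r)) (λ k → aCoeff (take m r) k *ℤ + Bcoeff (n + k) (drop m r) j)
Bcoeff-take-drop n m r j m<len =
  trans (cong (λ r′ → + Bcoeff n r′ j) (sym (take++drop≡id m r)))
        (Bcoeff-++ n (take m r) (drop m r) j (subst (0 <_) (sym (length-drop m r)) (m<n⇒0<n∸m m<len)))

theorem4 : (p q : ℕ) → 1 ≤ p → (r : List ℕ) → length r ≡ p + q → Linked _≤_ r → (n : ℕ)
  → ((j : ℕ) → + Bcoeff n (take p r) j
       ≡ sumTo (sum (take (p ∸ 1) r))
           (λ k → aCoeff (take (p ∸ 1) r) k *ℤ (+ Bcoeff (n + k) (drop (p ∸ 1) (take p r)) j)))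
    × ((j : ℕ) → + Bcoeff n r j
       ≡ sumTo (sum (take (p ∸ 1) r))
           (λ k → aCoeff (take (p ∸ 1) r) k *ℤ (+ Bcoeff (n + k) (drop (p ∸ 1) r) j)))
theorem4 (suc p) q _ r len _ n = firstBlocks , allBlocks
  where
  p<len : suc p ≤ length r
  p<len = subst (suc p ≤_) (sym len) (m≤m+n (suc p) q)
  prefix : take p (take (suc p) r) ≡ take p r
  prefix = trans (take-take p (suc p) r) (cong (λ m → take m r) (m≤n⇒m⊓n≡m (n≤1+n p)))
  firstBlocks : ∀ j → + Bcoeff n (take (suc p) r) j
    ≡ sumTo (sum (take p r)) (λ k → aCoeff (take p r) k *ℤ + Bcoeff (n + k) (drop p (take (suc p) r)) j)
  firstBlocks j =
    trans (Bcoeff-take-drop n p (take (suc p) r) j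
             (subst (p <_) (sym (trans (length-take (suc p) r) (m≤n⇒m⊓n≡m p<len))) ≤-refl))
          (cong (λ P → sumTo (sum P) (λ k → aCoeff P k *ℤ + Bcoeff (n + k) (drop p (take (suc p) r)) j)) prefix)
  allBlocks : ∀ j → + Bcoeff n r j
    ≡ sumTo (sum (take p r)) (λ k → aCoeff (take p r) k *ℤ + Bcoeff (n + k) (drop p r) j)
  allBlocks j = Bcoeff-take-drop n p r j p<len
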